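{- Let $(s,c)$ be a relaxed conflict propagation system on a finite simple undirected graph $G=(V,E)$ with parameters $\lambda\in(0,1)$ and $s_0>0$. If $(u,v)$ is a real edge such that $u$ has no incoming real edge (i.e. $u$ is a source of the digraph of real edges), then $c(u,v)\le s_0$.
   Context: $\widehat{E}=\{(u,v),(v,u):\{u,v\}\in E\}$; for $c:\widehat{E}\to\mathbb{N}$, $c_{in}(v)=\sum_{u\in N(v)}c(u,v)$ and $c_{out}(v)=\sum_{u\in N(v)}c(v,u)$. A relaxed conflict propagation system with parameters $\lambda\in(0,1)$ and constant $s_0>0$ is a pair $s:V\to\mathbb{N}$, $c:\widehat{E}\to\mathbb{N}$ such that (1R) for each $v$ with $s(v)\ge s_0$, $c_{in}(v)\ge\lambda\deg(v)s(v)+c_{out}(v)$; (2) for each $v$, $c_{out}(v)\le\frac{1-\lambda}{2}\deg(v)s(v)$; (3) for each $(u,v)\in\widehat{E}$, $c(u,v)\le s(u)$. A directed edge $(u,v)$ is real if $c(u,v)>0$. Nodes with $s(v)<s_0$ are called base nodes.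
   Formalization: The parameters λ and s₀ of the relaxed conflict propagation system are rational numbers rather than reals. -}

module Defs where

open import Data.Nat using (ℕ; zero; suc) renaming (_+_ to _+ℕ_; _<_ to _<ℕ_; _≤_ to _≤ℕ_)
open import Data.Fin using (Fin; zero; suc)
open import Data.Bool using (Bool; true; false; if_then_else_)
open import Data.Integer using (+_)
open import Data.Rational using (ℚ; _/_; _*_; _+_; _-_; _≤_; _<_; 0ℚ; 1ℚ; ½)
open import Relation.Binary.PropositionalEquality using (_≡_)
open import Data.Product using (_×_)

∑ : (n : ℕ) → (Fin n → ℕ) → ℕ
∑ zero    f = 0
∑ (suc n) f = f zero +ℕ ∑ n (λ i → f (suc i))

toℚ : ℕ → ℚ
toℚ n = + n / 1

record SimpleGraph (n : ℕ) : Set where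
  field
    adj      : Fin n → Fin n → Bool
    symmetric : ∀ u v → adj u v ≡ adj v u
    loopless  : ∀ v → adj v v ≡ false

module _ {n : ℕ} (G : SimpleGraph n) where
  open SimpleGraph G

  deg : Fin n → ℕ
  deg v = ∑ n (λ u → if adj v u then 1 else 0)

  -- c is given on all ordered pairs, but only its values on Ê
  -- (ordered pairs of adjacent vertices) are ever used.
  -- c_in(v) = Σ_{u ∈ N(v)} c(u,v)
  cin : (Fin n → Fin n → ℕ) → Fin n → ℕ
  cin c v = ∑ n (λ u → if adj u v then c u v else 0)

  cout : (Fin n → Fin n → ℕ) → Fin n → ℕ
  cout c v = ∑ n (λ u → if adj v u then c v u else 0)

  record RelaxedCPS (λ' s₀ : ℚ) (s : Fin n → ℕ) (c : Fin n → Fin n → ℕ) : Set where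
    field
      cond1R : ∀ v → s₀ ≤ toℚ (s v) →
               λ' * toℚ (deg v) * toℚ (s v) + toℚ (cout c v) ≤ toℚ (cin c v)
      cond2  : ∀ v → toℚ (cout c v) ≤ (1ℚ - λ') * ½ * toℚ (deg v) * toℚ (s v)
      cond3  : ∀ u v → adj u v ≡ true → c u v ≤ℕ s u

  RealEdge : (Fin n → Fin n → ℕ) → Fin n → Fin n → Set
  RealEdge c u v = (adj u v ≡ true) × (0 <ℕ c u v)

-- If s(u) < s₀ then c(u,v) ≤ s(u) < s₀ by (3). Otherwise (1R) applies at u and,
-- its λ·deg·s term being nonnegative, gives c_out(u) ≤ c_in(u). A source has
-- c_in(u) = 0, so c_out(u) = 0, contradicting c(u,v) > 0 for the real edge (u,v).
module Submission where

open import Defs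
open import Data.Nat using (ℕ; zero; suc; z≤n; s≤s) renaming (_≤_ to _≤ℕ_; _<_ to _<ℕ_)
import Data.Nat.Properties as ℕ
open import Data.Fin using (Fin; zero; suc)
open import Data.Bool using (true; false; if_then_else_)
open import Data.Rational using (ℚ; _≤_; _<_; 0ℚ; 1ℚ; mkℚ; _*_; _+_; *≤*; NonNegative; nonNegative)
import Data.Rational.Properties as ℚ
open import Data.Integer as ℤ using (+_; +≤+)
import Data.Integer.Properties as ℤ
open import Data.Nat.Coprimality using (1-coprimeTo) renaming (sym to coprime-sym)
open import Data.Empty using (⊥; ⊥-elim)
open import Data.Product using (_,_)
open import Relation.Binary.PropositionalEquality using (_≡_; refl; sym; cong; subst; subst₂)
open import Relation.Nullary using (¬_; yes; no)

toℚ≡mkℚ : ∀ n → toℚ n ≡ mkℚ (+ n) 0 (coprime-sym (1-coprimeTo n))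
toℚ≡mkℚ n = ℚ.normalize-coprime (coprime-sym (1-coprimeTo n))

toℚ-mono-≤ : ∀ {m n} → m ≤ℕ n → toℚ m ≤ toℚ n
toℚ-mono-≤ {m} {n} m≤n rewrite toℚ≡mkℚ m | toℚ≡mkℚ n =
  *≤* (subst₂ ℤ._≤_ (sym (ℤ.*-identityʳ (+ m))) (sym (ℤ.*-identityʳ (+ n))) (+≤+ m≤n))

toℚ-cancel-≤ : ∀ {m n} → toℚ m ≤ toℚ n → m ≤ℕ n
toℚ-cancel-≤ {m} {n} p rewrite toℚ≡mkℚ m | toℚ≡mkℚ n
  with subst₂ ℤ._≤_ (ℤ.*-identityʳ (+ m)) (ℤ.*-identityʳ (+ n)) (ℚ.drop-*≤* p)
... | +≤+ m≤n = m≤n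

toℚ-nonNegative : ∀ n → NonNegative (toℚ n)
toℚ-nonNegative n = nonNegative (toℚ-mono-≤ {0} {n} z≤n)

nonNeg+≤⇒≤ : ∀ p {q r} → .{{NonNegative p}} → p + q ≤ r → q ≤ r
nonNeg+≤⇒≤ p {q} p+q≤r =
  ℚ.≤-trans (subst (_≤ p + q) (ℚ.+-identityˡ q) (ℚ.+-monoˡ-≤ q (ℚ.nonNegative⁻¹ p))) p+q≤r

∑-zero : ∀ m (f : Fin m → ℕ) → (∀ i → f i ≡ 0) → ∑ m f ≡ 0
∑-zero zero    f f≡0 = refl
∑-zero (suc m) f f≡0 rewrite f≡0 zero = ∑-zero m (λ i → f (suc i)) (λ i → f≡0 (suc i))

≤-∑ : ∀ m (f : Fin m → ℕ) i → f i ≤ℕ ∑ m f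
≤-∑ (suc m) f zero    = ℕ.m≤m+n (f zero) _
≤-∑ (suc m) f (suc i) = ℕ.≤-trans (≤-∑ m (λ j → f (suc j)) i) (ℕ.m≤n+m _ (f zero))

module _ {n : ℕ} (G : SimpleGraph n) (c : Fin n → Fin n → ℕ) where
  open SimpleGraph G

  cin-source : ∀ u → (∀ w → ¬ RealEdge G c w u) → cin G c u ≡ 0
  cin-source u source = ∑-zero n _ term≡0
    where
    term≡0 : ∀ w → (if adj w u then c w u else 0) ≡ 0
    term≡0 w with adj w u in adj≡ | c w u in c≡
    ... | false | _     = refl
    ... | true  | zero  = refl
    ... | true  | suc _ = ⊥-elim (source w (adj≡ , subst (0 <ℕ_) (sym c≡) (s≤s z≤n)))

  ≤-cout : ∀ {u v} → adj u v ≡ true → c u v ≤ℕ cout G c u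
  ≤-cout {u} {v} adj≡ = subst (_≤ℕ cout G c u) (cong (λ b → if b then c u v else 0) adj≡)
    (≤-∑ n (λ w → if adj u w then c u w else 0) v)

  cout≤cin : ∀ {λ' s₀ s} → 0ℚ ≤ λ' → RelaxedCPS G λ' s₀ s c →
             ∀ v → s₀ ≤ toℚ (s v) → cout G c v ≤ℕ cin G c v
  cout≤cin {λ'} {s₀} {s} 0≤λ cps v nonBase =
    toℚ-cancel-≤ (nonNeg+≤⇒≤ (λ' * toℚ (deg G v) * toℚ (s v)) (RelaxedCPS.cond1R cps v nonBase))
    where
    instance
      _ = nonNegative 0≤λ
      _ = toℚ-nonNegative (deg G v)
      _ = toℚ-nonNegative (s v)
      _ = ℚ.nonNeg*nonNeg⇒nonNeg λ' (toℚ (deg G v))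
      _ = ℚ.nonNeg*nonNeg⇒nonNeg (λ' * toℚ (deg G v)) (toℚ (s v))

lemma3 : {n : ℕ} (G : SimpleGraph n) (λ' s₀ : ℚ) →
           0ℚ < λ' → λ' < 1ℚ → 0ℚ < s₀ →
           (s : Fin n → ℕ) (c : Fin n → Fin n → ℕ) →
           RelaxedCPS G λ' s₀ s c →
           (u v : Fin n) → RealEdge G c u v →
           (∀ w → RealEdge G c w u → ⊥) →
           toℚ (c u v) ≤ s₀
lemma3 G λ' s₀ 0<λ _ _ s c cps u v (adj≡ , 0<c) source with s₀ ℚ.≤? toℚ (s u)
... | no base = ℚ.≤-trans (toℚ-mono-≤ (RelaxedCPS.cond3 cps u v adj≡)) (ℚ.<⇒≤ (ℚ.≰⇒> base))
... | yes nonBase = ⊥-elim (ℕ.<⇒≱ 0<cout cout≤0)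
  where
  0<cout : 0 <ℕ cout G c u
  0<cout = ℕ.<-≤-trans 0<c (≤-cout G c adj≡)
  cout≤0 : cout G c u ≤ℕ 0
  cout≤0 = subst (cout G c u ≤ℕ_) (cin-source G c u source) (cout≤cin G c (ℚ.<⇒≤ 0<λ) cps u nonBase)
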